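{- Let $G$ be a weighted game arena with partial observation, $\ell_{\max}\in\mathbb{N}_0$, $\rho=o_0\sigma_0\dots o_n$ a finite abstract path, $\phi\in\mathcal{F}$ with $\mathrm{supp}(\phi)\subseteq o_0$, and $\mathrm{supp}^{ -1}(\rho,\phi)=f_0\sigma_0\dots f_n$. Let $p\in\mathrm{supp}(f_n)$ and $1\le l\le\ell_{\max}$ with $l\le n$. Then there is a window of length $l$ open at $p$ — that is, there is a concrete path $q_0\sigma_0\dots q_n\in\gamma(\rho)$ with $q_0\in\mathrm{supp}(\phi)$ and $q_n=p$ such that $\sum_{j=n-l}^{m}w(q_j,\sigma_j,q_{j+1})<0$ for all $n-l\le m<n$ — if and only if $f_n(p)_l<0$.
   Context: A WGA is $G=\langle Q,q_I,\Sigma,\Delta,w,Obs\rangle$: $Q$ finite set of states, $q_I\in Q$, $\Sigma$ finite set of actions, $\Delta\subseteq Q\times\Sigma\times Q$ total transition relation, $w:\Delta\to\mathbb{Z}$, $Obs$ a partition of $Q$ with $\{q_I\}\in Obs$; $W=\max\{|w(t)|:t\in\Delta\}$; $\mathrm{post}_\sigma(s)=\{q':\exists q\in s,(q,\sigma,q')\in\Delta\}$. A finite abstract path $o_0\sigma_0\dots o_n$ ($o_i\in Obs$) is one for which some concrete path $q_0\sigma_0\dots q_n$ (with $(q_i,\sigma_i,q_{i+1})\in\Delta$) has $q_i\in o_i$ for all $i$; $\gamma(\rho)$ is the set of all such concrete paths. $\mathbb{N}_0=\{1,2,\dots\}$. Fix $\ell_{\max}\in\mathbb{N}_0$. $\mathcal{F}$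 is the set of all functions $f:Q\to(\{1,\dots,\ell_{\max}\}\to\{ -W\ell_{\max},\dots,0\})\cup\{\bot\}$; $\mathrm{supp}(f)=\{q:f(q)\ne\bot\}$ and $f(q)_i=f(q)(i)$. For $f_1,f_2\in\mathcal{F}$ and $\sigma\in\Sigma$, $f_2$ is a $\sigma$-successor of $f_1$ if $\mathrm{supp}(f_2)=\mathrm{post}_\sigma(\mathrm{supp}(f_1))\cap o$ for some $o\in Obs$, and for all $q\in\mathrm{supp}(f_2)$ and $1\le j\le\ell_{\max}$, $f_2(q)_j=\max\{ -W\ell_{\max},\min\{0,\zeta_j(q)\}\}$, where $\zeta_1(q)=\min\{w(p,\sigma,q):p\in\mathrm{supp}(f_1),(p,\sigma,q)\in\Delta\}$ and, for $j\ge2$, $\zeta_j(q)=\min\{f_1(p)_{j-1}+w(p,\sigma,q):p\in\mathrm{supp}(f_1),(p,\sigma,q)\in\Delta,f_1(p)_{j-1}<0\}$ (the minimum of the empty set being $+\infty$). For a finite abstract path $\rho=o_0\sigma_0\dots o_n$ and $\phi\in\mathcal{F}$ with $\mathrm{supp}(\phi)\subseteq o_0$, $\mathrm{supp}^{ -1}(\rho,\phi)=f_0\sigma_0f_1\dots f_n$ where $f_0=\phi$ and $f_{i+1}$ is the $\sigma_i$-successor of $f_i$ with $\mathrm{supp}(f_{i+1})=\mathrm{post}_{\sigma_i}(\mathrm{supp}(f_i))\cap o_{i+1}$. -}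

module Defs where

open import Data.Nat as ℕ using (ℕ; zero; suc; _∸_)
open import Data.Fin using (Fin; zero; suc; inject₁; toℕ)
open import Data.List using (List; foldr; map; allFin; applyUpTo)
open import Data.Bool.ListAction using (any)
open import Data.Bool using (Bool; true; false; _∧_; if_then_else_)
open import Data.Maybe using (Maybe; just; nothing; is-just)
open import Data.Integer as ℤ using (ℤ; +_; -_; _⊔_; _⊓_; ∣_∣)
open import Data.Product using (Σ; ∃; _×_; _,_)
open import Relation.Binary.PropositionalEquality using (_≡_)
open import Relation.Nullary using (¬_)
open import Relation.Nullary.Decidable using (⌊_⌋)
open import Data.Fin.Properties using () renaming (_≟_ to _≟ᶠ_)

-- A weighted game arena with partial observation.
-- States are Fin nQ, actions Fin nA, observations are labelled by Fin nO:
-- the partition Obs is the set of non-empty fibres of  obs : Q → Fin nO.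
record WGA : Set where
  field
    nQ nA nO : ℕ
    qI       : Fin nQ
    Δ        : Fin nQ → Fin nA → Fin nQ → Bool
    total    : ∀ q σ → ∃ λ q' → Δ q σ q' ≡ true
    w        : Fin nQ → Fin nA → Fin nQ → ℤ      -- only relevant on transitions
    obs      : Fin nQ → Fin nO
    qI-alone : ∀ q → obs q ≡ obs qI → q ≡ qI

module _ (G : WGA) where
  open WGA G

  Q = Fin nQ
  Act = Fin nA
  Ob = Fin nO

  allQ : List Q
  allQ = allFin nQ

  allA : List Act
  allA = allFin nA

  Wmax : ℕ
  Wmax = foldr ℕ._⊔_ 0
           (map (λ q → foldr ℕ._⊔_ 0
             (map (λ σ → foldr ℕ._⊔_ 0
               (map (λ q' → if Δ q σ q' then ∣ w q σ q' ∣ else 0) allQ)) allA)) allQ)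

  -- Elements of 𝓕 (before range constraint): f(q) = nothing is ⊥,
  -- f(q) = just g with g i = f(q)_{toℕ i + 1}.
  FF : ℕ → Set
  FF ℓmax = Q → Maybe (Fin ℓmax → ℤ)

  InRange : (ℓmax : ℕ) → FF ℓmax → Set
  InRange ℓmax f = ∀ q g → f q ≡ just g → ∀ i →
    (- (+ (Wmax ℕ.* ℓmax))) ℤ.≤ g i × g i ℤ.≤ + 0

  -- ℤ ∪ {+∞}
  min∞ : Maybe ℤ → Maybe ℤ → Maybe ℤ
  min∞ nothing y = y
  min∞ (just x) nothing = just x
  min∞ (just x) (just y) = just (x ⊓ y)

  clamp : ℕ → Maybe ℤ → ℤ
  clamp ℓmax nothing = - (+ (Wmax ℕ.* ℓmax)) ⊔ + 0
  clamp ℓmax (just z) = - (+ (Wmax ℕ.* ℓmax)) ⊔ (+ 0 ⊓ z)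

  prevIdx : ∀ {m} → Fin m → Maybe (Fin m)
  prevIdx zero = nothing
  prevIdx (suc i) = just (inject₁ i)

  inPost : ∀ {ℓmax} → FF ℓmax → Act → Q → Bool
  inPost f σ q = any (λ p → is-just (f p) ∧ Δ p σ q) allQ

  ζ : ∀ {ℓmax} → FF ℓmax → Act → Q → Fin ℓmax → Maybe ℤ
  ζ f σ q j = foldr min∞ nothing (map term allQ)
    where
    term : Q → Maybe ℤ
    term p with f p | Δ p σ q | prevIdx j
    ... | nothing | _ | _ = nothing
    ... | just _ | false | _ = nothing
    ... | just _ | true | nothing = just (w p σ q)
    ... | just g | true | just j' =
          if ⌊ g j' ℤ.<? + 0 ⌋ then just (g j' ℤ.+ w p σ q) else nothing

  succF : ∀ {ℓmax} → FF ℓmax → Act → Ob → FF ℓmax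
  succF {ℓmax} f σ o q =
    if inPost f σ q ∧ ⌊ obs q ≟ᶠ o ⌋
      then just (λ j → clamp ℓmax (ζ f σ q j))
      else nothing

  -- supp⁻¹(ρ, φ): the i-th function f_i, for ρ given by os, σs (indices ≤ n used)
  suppInv : ∀ {ℓmax} → (os : ℕ → Ob) (σs : ℕ → Act) → FF ℓmax → ℕ → FF ℓmax
  suppInv os σs φ zero = φ
  suppInv os σs φ (suc i) = succF (suppInv os σs φ i) (σs i) (os (suc i))

  InGamma : (n : ℕ) (os : ℕ → Ob) (σs : ℕ → Act) (qs : ℕ → Q) → Set
  InGamma n os σs qs =
    (∀ i → i ℕ.≤ n → obs (qs i) ≡ os i) ×
    (∀ i → i ℕ.< n → Δ (qs i) (σs i) (qs (suc i)) ≡ true)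

  AbstractPath : (n : ℕ) (os : ℕ → Ob) (σs : ℕ → Act) → Set
  AbstractPath n os σs = ∃ λ qs → InGamma n os σs qs

  sumFromTo : (σs : ℕ → Act) (qs : ℕ → Q) (a m : ℕ) → ℤ
  sumFromTo σs qs a m =
    foldr ℤ._+_ (+ 0) (applyUpTo (λ k → w (qs (a ℕ.+ k)) (σs (a ℕ.+ k)) (qs (suc (a ℕ.+ k))))
                   (suc m ∸ a))

  WindowOpen : (n : ℕ) (os : ℕ → Ob) (σs : ℕ → Act) {ℓmax : ℕ} (φ : FF ℓmax)
               (l : ℕ) (p : Q) → Set
  WindowOpen n os σs φ l p = ∃ λ qs →
    InGamma n os σs qs ×
    is-just (φ (qs 0)) ≡ true ×
    qs n ≡ p ×
    (∀ m → n ∸ l ℕ.≤ m → m ℕ.< n → sumFromTo σs qs (n ∸ l) m ℤ.< + 0)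

-- Induction on the window length l. If a run from supp(φ) reaches p at step n with its window of
-- length l open, its last l − 1 steps form an open window ending at the predecessor q, so by
-- induction f_{n−1}(q)_{l−1} is negative and at most their sum. Then q offers ζ_l(p) a candidate
-- at most the whole window sum, and so f_n(p)_l is at most that sum too: the clamp at −W·ℓmax never
-- binds, as l steps weigh at least −W·l. Conversely, if f_n(p)_l < 0, the minimum ζ_l(p) is attained
-- by a predecessor whose value at l − 1 is negative; by induction it ends a run with an open window
-- of length l − 1, and the edge to p keeps every partial sum negative. The runs start in supp(φ)
-- because every state of supp(f_k) is reachable at step k from supp(φ) along ρ.
module Submission where

open import Defs
open import Data.Nat as ℕ using (ℕ; zero; suc; _≤_; _∸_; z≤n; s≤s)
import Data.Nat.Properties as ℕ
open import Data.Fin as Fin using (Fin; zero; suc; toℕ; inject₁)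
import Data.Fin.Properties as Fin
open import Data.Integer as ℤ using (ℤ; +_; -_; _<_; _⊔_; ∣_∣; -[1+_]; +≤+)
import Data.Integer.Properties as ℤ
open import Data.Maybe using (Maybe; just; nothing; is-just)
open import Data.Bool using (true; if_then_else_)
open import Data.Bool.Properties using (T-≡; T-∧)
open import Data.List using (_∷_; foldr; map; applyUpTo)
open import Data.List.Properties using (foldr-preservesᵒ)
open import Data.List.Membership.Propositional using (_∈_; lose)
open import Data.List.Membership.Propositional.Properties using (∈-allFin; ∈-map⁺)
open import Data.List.Relation.Unary.Any as Any using (here; there; satisfied)
open import Data.List.Relation.Unary.Any.Properties using (any⁺; any⁻)
open import Data.Product using (∃; _×_; _,_)
open import Data.Sum using (_⊎_; inj₁; inj₂; [_,_])
open import Relation.Nullary using (yes; no; contradiction)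
open import Relation.Binary.PropositionalEquality
  using (_≡_; refl; sym; trans; cong; cong₂; subst; module ≡-Reasoning)
open import Function.Bundles using (_⇔_; mk⇔; Equivalence)
import Function.Properties.Equivalence as ⇔

≤-foldr-⊔ : ∀ {A : Set} (h : A → ℕ) {x xs} → x ∈ xs → h x ≤ foldr ℕ._⊔_ 0 (map h xs)
≤-foldr-⊔ h x∈xs =
  foldr-preservesᵒ ⊔-upper 0 _ (inj₂ (Any.map ℕ.≤-reflexive (∈-map⁺ h x∈xs)))
  where
  ⊔-upper : ∀ {v} m n → v ≤ m ⊎ v ≤ n → v ≤ m ℕ.⊔ n
  ⊔-upper m n = [ ℕ.m≤n⇒m≤n⊔o n , ℕ.m≤n⇒m≤o⊔n m ]

∣i∣≤n⇒-n≤i : ∀ {i n} → ∣ i ∣ ≤ n → - (+ n) ℤ.≤ i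
∣i∣≤n⇒-n≤i {+ _}       _      = ℤ.neg-≤-pos
∣i∣≤n⇒-n≤i { -[1+ _ ]} ∣i∣≤n = ℤ.neg-mono-≤ (+≤+ ∣i∣≤n)

foldr-+-applyUpTo-suc : ∀ (h : ℕ → ℤ) n →
  foldr ℤ._+_ (+ 0) (applyUpTo h (suc n)) ≡ foldr ℤ._+_ (+ 0) (applyUpTo h n) ℤ.+ h n
foldr-+-applyUpTo-suc h zero    = trans (ℤ.+-identityʳ (h 0)) (sym (ℤ.+-identityˡ (h 0)))
foldr-+-applyUpTo-suc h (suc n) =
  trans (cong (ℤ._+_ (h 0)) (foldr-+-applyUpTo-suc (λ k → h (suc k)) n))
        (sym (ℤ.+-assoc (h 0) _ (h (suc n))))

is-just⇒≡just : ∀ {A : Set} {m : Maybe A} → is-just m ≡ true → ∃ λ x → m ≡ just x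
is-just⇒≡just {m = just x} _ = x , refl

-- A predecessor p with f(p) = h and w(p, σ, q) = x contributes v to ζ_j(q); the Fin index j is the
-- paper's j + 1.
data Candidate : ∀ {m} → (Fin m → ℤ) → ℤ → Fin m → ℤ → Set where
  first : ∀ {m} {h : Fin (suc m) → ℤ} {x} → Candidate h x zero x
  later : ∀ {m} {h : Fin (suc m) → ℤ} {x} {i : Fin m} →
          h (inject₁ i) < + 0 → Candidate h x (suc i) (h (inject₁ i) ℤ.+ x)

module _ (G : WGA) where
  open WGA G

  ∣w∣≤Wmax : ∀ {q σ q′} → Δ q σ q′ ≡ true → ∣ w q σ q′ ∣ ≤ Wmax G
  ∣w∣≤Wmax {q} {σ} {q′} d =
    ℕ.≤-trans (ℕ.≤-reflexive (sym (cong (if_then ∣ w q σ q′ ∣ else 0) d)))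
      (ℕ.≤-trans (≤-foldr-⊔ _ (∈-allFin q′))
        (ℕ.≤-trans (≤-foldr-⊔ _ (∈-allFin σ)) (≤-foldr-⊔ _ (∈-allFin q))))

  -Wmax≤w : ∀ {q σ q′} → Δ q σ q′ ≡ true → - (+ Wmax G) ℤ.≤ w q σ q′
  -Wmax≤w d = ∣i∣≤n⇒-n≤i (∣w∣≤Wmax d)

  min∞-≤ˡ : ∀ {a v} b → a ≡ just v → ∃ λ z → min∞ G a b ≡ just z × z ℤ.≤ v
  min∞-≤ˡ nothing  refl = _ , refl , ℤ.≤-refl
  min∞-≤ˡ (just r) refl = _ , refl , ℤ.i⊓j≤i _ r

  min∞-≤ʳ : ∀ a {b v} → b ≡ just v → ∃ λ z → min∞ G a b ≡ just z × z ℤ.≤ v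
  min∞-≤ʳ nothing  refl = _ , refl , ℤ.≤-refl
  min∞-≤ʳ (just u) refl = _ , refl , ℤ.i⊓j≤j u _

  min∞-sel : ∀ a b {z} → min∞ G a b ≡ just z → a ≡ just z ⊎ b ≡ just z
  min∞-sel nothing  b        e = inj₂ e
  min∞-sel (just u) nothing  e = inj₁ e
  min∞-sel (just u) (just r) e with ℤ.⊓-sel u r
  ... | inj₁ u⊓r≡u = inj₁ (trans (cong just (sym u⊓r≡u)) e)
  ... | inj₂ u⊓r≡r = inj₂ (trans (cong just (sym u⊓r≡r)) e)

  foldr-min∞-≤ : ∀ {A : Set} {t : A → Maybe ℤ} {xs m} →
                 m ≡ foldr (min∞ G) nothing (map t xs) → ∀ {x} → x ∈ xs →
                 (v : ℤ) → t x ≡ just v → ∃ λ z → m ≡ just z × z ℤ.≤ v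
  foldr-min∞-≤ refl (here refl) v tx = min∞-≤ˡ _ tx
  foldr-min∞-≤ {t = t} {y ∷ _} refl (there x∈xs) v tx with foldr-min∞-≤ refl x∈xs v tx
  ... | z , e , z≤v with min∞-≤ʳ (t y) e
  ...   | z′ , e′ , z′≤z = z′ , e′ , ℤ.≤-trans z′≤z z≤v

  foldr-min∞-attained : ∀ {A : Set} {t : A → Maybe ℤ} {xs m} →
                        m ≡ foldr (min∞ G) nothing (map t xs) →
                        ∀ {z} → m ≡ just z → ∃ λ x → t x ≡ just z
  foldr-min∞-attained {t = t} {y ∷ xs} refl e with min∞-sel (t y) _ e
  ... | inj₁ ty≡z   = y , ty≡z
  ... | inj₂ rest≡z = foldr-min∞-attained {xs = xs} refl rest≡z

  -- The summand of ζ is where-bound in its definition and cannot be named here. The fold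
  -- lemmas receive it by unifying their first argument with the unfolded ζ, and the
  -- subsequent with-abstractions make it compute inside the types of the bound results.
  ζ-≤ : ∀ {ℓ} {f : FF G ℓ} {σ q p h j v} → f p ≡ just h → Δ p σ q ≡ true →
        Candidate h (w p σ q) j v → ∃ λ z → ζ G f σ q j ≡ just z × z ℤ.≤ v
  ζ-≤ {f = f} {σ} {q} {p} {j = j} {v} fp d c
    with foldr-min∞-≤ {m = ζ G f σ q j} refl (∈-allFin p) v
  ζ-≤ fp d first | bound rewrite fp | d = bound refl
  ζ-≤ {h = h} fp d (later {i = i} h[i]<0) | bound rewrite fp | d with h (inject₁ i) ℤ.<? + 0
  ... | yes _    = bound refl
  ... | no h[i]≮0 = contradiction h[i]<0 h[i]≮0

  ζ-attained : ∀ {ℓ} {f : FF G ℓ} {σ q j z} → ζ G f σ q j ≡ just z →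
               ∃ λ p → ∃ λ h → f p ≡ just h × Δ p σ q ≡ true × Candidate h (w p σ q) j z
  ζ-attained {f = f} {σ} {q} {j} e
    with foldr-min∞-attained {xs = allQ G} {m = ζ G f σ q j} refl e
  ... | p , tp with f p in fp | Δ p σ q in d
  ζ-attained {j = zero}  e | p , refl | just h | true = p , h , fp , d , first
  ζ-attained {j = suc i} e | p , tp   | just h | true with h (inject₁ i) ℤ.<? + 0
  ζ-attained {j = suc i} e | p , refl | just h | true | yes h[i]<0 = p , h , fp , d , later h[i]<0

  clamp-≤ : ∀ ℓ {z x} → - (+ (Wmax G ℕ.* ℓ)) ℤ.≤ x → z ℤ.≤ x → clamp G ℓ (just z) ℤ.≤ x
  clamp-≤ ℓ {z} floor≤x z≤x = ℤ.⊔-lub floor≤x (ℤ.≤-trans (ℤ.i⊓j≤j (+ 0) z) z≤x)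

  clamp-<0 : ∀ ℓ m → clamp G ℓ m < + 0 → ∃ λ z → m ≡ just z × z ℤ.≤ clamp G ℓ m
  clamp-<0 ℓ nothing  c<0 = contradiction c<0 (ℤ.≤⇒≯ (ℤ.i≤j⊔i _ (+ 0)))
  clamp-<0 ℓ (just z) c<0 with ℤ.⊓-sel (+ 0) z
  ... | inj₁ 0⊓z≡0 =
    contradiction c<0 (ℤ.≤⇒≯ (subst (λ y → + 0 ℤ.≤ _ ⊔ y) (sym 0⊓z≡0) (ℤ.i≤j⊔i _ (+ 0))))
  ... | inj₂ 0⊓z≡z = z , refl , subst (λ y → z ℤ.≤ _ ⊔ y) (sym 0⊓z≡z) (ℤ.i≤j⊔i _ z)

  inPost-intro : ∀ {ℓ} {f : FF G ℓ} {σ q p} → is-just (f p) ≡ true → Δ p σ q ≡ true →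
                 inPost G f σ q ≡ true
  inPost-intro {p = p} fp d = Equivalence.to T-≡ (any⁺ _ (lose (∈-allFin p)
    (Equivalence.from T-∧ (Equivalence.from T-≡ fp , Equivalence.from T-≡ d))))

  inPost-elim : ∀ {ℓ} {f : FF G ℓ} {σ q} → inPost G f σ q ≡ true →
                ∃ λ p → is-just (f p) ≡ true × Δ p σ q ≡ true
  inPost-elim e with satisfied (any⁻ _ (allQ G) (Equivalence.from T-≡ e))
  ... | p , t with Equivalence.to T-∧ t
  ...   | fp , d = p , Equivalence.to T-≡ fp , Equivalence.to T-≡ d

  succF-just⁻ : ∀ {ℓ} {f : FF G ℓ} {σ o q g} → succF G f σ o q ≡ just g →
                inPost G f σ q ≡ true × obs q ≡ o × (∀ j → g j ≡ clamp G ℓ (ζ G f σ q j))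
  succF-just⁻ {f = f} {σ} {o} {q} e with inPost G f σ q | obs q Fin.≟ o | e
  ... | true | yes obs≡o | refl = refl , obs≡o , λ _ → refl

  succF-is-just : ∀ {ℓ} {f : FF G ℓ} {σ o q} → inPost G f σ q ≡ true → obs q ≡ o →
                  is-just (succF G f σ o q) ≡ true
  succF-is-just {o = o} {q} post obs≡o rewrite post with obs q Fin.≟ o
  ... | yes _      = refl
  ... | no obs≢o = contradiction obs≡o obs≢o

  succF-≤ : ∀ {ℓ} {f : FF G ℓ} {σ o q g p h j v x} → succF G f σ o q ≡ just g →
            f p ≡ just h → Δ p σ q ≡ true → Candidate h (w p σ q) j v →
            - (+ (Wmax G ℕ.* ℓ)) ℤ.≤ x → v ℤ.≤ x → g j ℤ.≤ x
  succF-≤ {ℓ} {f} {σ} {q = q} {g} {j = j} {x = x} e fp d c floor≤x v≤x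
    with succF-just⁻ e | ζ-≤ {f = f} fp d c
  ... | _ , _ , g≡ | z , ζ≡z , z≤v = begin
    g j                      ≡⟨ g≡ j ⟩
    clamp G ℓ (ζ G f σ q j)  ≡⟨ cong (clamp G ℓ) ζ≡z ⟩
    clamp G ℓ (just z)       ≤⟨ clamp-≤ ℓ floor≤x (ℤ.≤-trans z≤v v≤x) ⟩
    x                        ∎
    where open ℤ.≤-Reasoning

  succF-<0 : ∀ {ℓ} {f : FF G ℓ} {σ o q g j} → succF G f σ o q ≡ just g → g j < + 0 →
             ∃ λ p → ∃ λ h → ∃ λ v →
               f p ≡ just h × Δ p σ q ≡ true × Candidate h (w p σ q) j v × v ℤ.≤ g j
  succF-<0 {ℓ} {f} {σ} {q = q} {j = j} e g[j]<0 with succF-just⁻ e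
  ... | _ , _ , g≡ with clamp-<0 ℓ (ζ G f σ q j) (subst (_< + 0) (g≡ j) g[j]<0)
  ...   | z , ζ≡z , z≤c with ζ-attained ζ≡z
  ...     | p , h , fp , d , c = p , h , z , fp , d , c , subst (z ℤ.≤_) (sym (g≡ j)) z≤c

module Runs (G : WGA) {ℓ : ℕ} (os : ℕ → Ob G) (σs : ℕ → Act G) (φ : FF G ℓ) where
  open WGA G

  f : ℕ → FF G ℓ
  f = suppInv G os σs φ

  Run : ℕ → (ℕ → Q G) → Set
  Run k qs = InGamma G k os σs qs × is-just (φ (qs 0)) ≡ true

  RunTo : ℕ → (ℕ → Q G) → Q G → Set
  RunTo k qs q = Run k qs × qs k ≡ q

  Supp⊆o₀ : Set
  Supp⊆o₀ = ∀ q → is-just (φ q) ≡ true → obs q ≡ os 0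

  Run-pred : ∀ {k qs} → Run (suc k) qs → Run k qs
  Run-pred ((obs≡ , steps) , φ₀) =
    ((λ i i≤k → obs≡ i (ℕ.m≤n⇒m≤1+n i≤k)) , (λ i i<k → steps i (ℕ.m<n⇒m<1+n i<k))) , φ₀

  Run-step : ∀ {k qs i} → Run k qs → i ℕ.< k → Δ (qs i) (σs i) (qs (suc i)) ≡ true
  Run-step ((_ , steps) , _) = steps _

  Run-supp : ∀ {k qs} → Run k qs → ∀ i → i ≤ k → is-just (f i (qs i)) ≡ true
  Run-supp (_ , φ₀) zero _ = φ₀
  Run-supp run@((obs≡ , _) , _) (suc i) i<k =
    succF-is-just G (inPost-intro G (Run-supp run i (ℕ.<⇒≤ i<k)) (Run-step run i<k))
                    (obs≡ (suc i) i<k)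

  extend : (ℕ → Q G) → ℕ → Q G → ℕ → Q G
  extend qs k q i with i ℕ.≤? k
  ... | yes _ = qs i
  ... | no _  = q

  extend-≤ : ∀ qs {k} q {i} → i ≤ k → extend qs k q i ≡ qs i
  extend-≤ qs {k} q {i} i≤k with i ℕ.≤? k
  ... | yes _   = refl
  ... | no i≰k = contradiction i≤k i≰k

  extend-suc : ∀ qs k q → extend qs k q (suc k) ≡ q
  extend-suc qs k q with suc k ℕ.≤? k
  ... | yes 1+k≤k = contradiction 1+k≤k ℕ.1+n≰n
  ... | no _      = refl

  RunTo-extend : ∀ {k qs p q} → RunTo k qs p → Δ p (σs k) q ≡ true → obs q ≡ os (suc k) →
                 RunTo (suc k) (extend qs k q) q
  RunTo-extend {k} {qs} {p} {q} (((obs≡ , steps) , φ₀) , refl) p→q obs≡′ =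
    ((obs≡′′ , steps′) , subst (λ x → is-just (φ x) ≡ true) (sym (extend-≤ qs {k} q z≤n)) φ₀) ,
    extend-suc qs k q
    where
    obs≡′′ : ∀ i → i ≤ suc k → obs (extend qs k q i) ≡ os i
    obs≡′′ i i≤1+k with ℕ.m≤n⇒m<n∨m≡n i≤1+k
    ... | inj₁ (s≤s i≤k) rewrite extend-≤ qs q i≤k = obs≡ i i≤k
    ... | inj₂ refl      rewrite extend-suc qs k q = obs≡′
    steps′ : ∀ i → i ℕ.< suc k → Δ (extend qs k q i) (σs i) (extend qs k q (suc i)) ≡ true
    steps′ i (s≤s i≤k) with ℕ.m≤n⇒m<n∨m≡n i≤k
    ... | inj₁ i<k rewrite extend-≤ qs q i≤k | extend-≤ qs q i<k = steps i i<k
    ... | inj₂ refl rewrite extend-≤ qs q i≤k | extend-suc qs k q = p→q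

  reach : Supp⊆o₀ → ∀ k {q} → is-just (f k q) ≡ true → ∃ λ qs → RunTo k qs q
  reach φ⊆o₀ zero {q} φq = (λ _ → q) , ((obs≡ , λ _ ()) , φq) , refl
    where
    obs≡ : ∀ i → i ≤ 0 → obs q ≡ os i
    obs≡ zero z≤n = φ⊆o₀ q φq
  reach φ⊆o₀ (suc k) fq with is-just⇒≡just fq
  ... | _ , fq≡g with succF-just⁻ G fq≡g
  ...   | post , obs≡ , _ with inPost-elim G post
  ...     | p , fp , p→q with reach φ⊆o₀ k fp
  ...       | qs , runTo = extend qs k _ , RunTo-extend runTo p→q obs≡

  stepWeight : (ℕ → Q G) → ℕ → ℤ
  stepWeight qs t = w (qs t) (σs t) (qs (suc t))

  windowSum : (ℕ → Q G) → ℕ → ℕ → ℤ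
  windowSum qs a len = foldr ℤ._+_ (+ 0) (applyUpTo (λ k → stepWeight qs (a ℕ.+ k)) len)

  sumFromTo≡windowSum : ∀ qs a e → sumFromTo G σs qs a (e ℕ.+ a) ≡ windowSum qs a (suc e)
  sumFromTo≡windowSum qs a e = cong (windowSum qs a) (ℕ.m+n∸n≡m (suc e) a)

  windowSum-suc : ∀ qs a len →
                  windowSum qs a (suc len) ≡ windowSum qs a len ℤ.+ stepWeight qs (len ℕ.+ a)
  windowSum-suc qs a len = trans (foldr-+-applyUpTo-suc _ len)
    (cong (λ t → windowSum qs a len ℤ.+ stepWeight qs t) (ℕ.+-comm a len))

  windowSum-one : ∀ qs a → windowSum qs a 1 ≡ stepWeight qs a
  windowSum-one qs a = trans (windowSum-suc qs a 0) (ℤ.+-identityˡ _)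

  windowSum-cong : ∀ {qs qs′} a len → (∀ t → t ≤ len ℕ.+ a → qs t ≡ qs′ t) →
                   windowSum qs a len ≡ windowSum qs′ a len
  windowSum-cong a zero      _  = refl
  windowSum-cong {qs} {qs′} a (suc len) eq = begin
    windowSum qs a (suc len)                             ≡⟨ windowSum-suc qs a len ⟩
    windowSum qs a len ℤ.+ stepWeight qs (len ℕ.+ a)     ≡⟨ cong₂ ℤ._+_ prefix last ⟩
    windowSum qs′ a len ℤ.+ stepWeight qs′ (len ℕ.+ a)   ≡⟨ windowSum-suc qs′ a len ⟨
    windowSum qs′ a (suc len)                            ∎
    where
    open ≡-Reasoning
    prefix : windowSum qs a len ≡ windowSum qs′ a len
    prefix = windowSum-cong a len (λ t t≤len+a → eq t (ℕ.m≤n⇒m≤1+n t≤len+a))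
    last : stepWeight qs (len ℕ.+ a) ≡ stepWeight qs′ (len ℕ.+ a)
    last = cong₂ (λ x y → w x (σs (len ℕ.+ a)) y) (eq _ (ℕ.n≤1+n _)) (eq _ ℕ.≤-refl)

  windowSum-≥ : ∀ {k qs} a len → Run k qs → len ℕ.+ a ≤ k →
                - (+ (len ℕ.* Wmax G)) ℤ.≤ windowSum qs a len
  windowSum-≥ a zero      _   _   = ℤ.≤-refl
  windowSum-≥ {qs = qs} a (suc len) run len+a<k = begin
    - (+ (Wmax G ℕ.+ len ℕ.* Wmax G))                  ≡⟨ cong -_ (ℤ.pos-+ (Wmax G) _) ⟩
    - (+ Wmax G ℤ.+ + (len ℕ.* Wmax G))                ≡⟨ ℤ.neg-distrib-+ (+ Wmax G) _ ⟩
    - (+ Wmax G) ℤ.+ - (+ (len ℕ.* Wmax G))            ≡⟨ ℤ.+-comm (- (+ Wmax G)) _ ⟩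
    - (+ (len ℕ.* Wmax G)) ℤ.+ - (+ Wmax G)            ≤⟨ ℤ.+-mono-≤ (windowSum-≥ a len run (ℕ.<⇒≤ len+a<k))
                                                                     (-Wmax≤w G (Run-step run len+a<k)) ⟩
    windowSum qs a len ℤ.+ stepWeight qs (len ℕ.+ a)   ≡⟨ windowSum-suc qs a len ⟨
    windowSum qs a (suc len)                           ∎
    where open ℤ.≤-Reasoning

  windowSum-floor : ∀ {k qs} a len → Run k qs → len ℕ.+ a ≤ k → len ≤ ℓ →
                    - (+ (Wmax G ℕ.* ℓ)) ℤ.≤ windowSum qs a len
  windowSum-floor a len run len+a≤k len≤ℓ =
    ℤ.≤-trans (ℤ.neg-mono-≤ (+≤+ len*W≤W*ℓ)) (windowSum-≥ a len run len+a≤k)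
    where
    len*W≤W*ℓ : len ℕ.* Wmax G ≤ Wmax G ℕ.* ℓ
    len*W≤W*ℓ = ℕ.≤-trans (ℕ.≤-reflexive (ℕ.*-comm len (Wmax G))) (ℕ.*-monoʳ-≤ (Wmax G) len≤ℓ)

  OpenWindow : (ℕ → Q G) → ℕ → ℕ → Set
  OpenWindow qs a len = ∀ e → e ℕ.< len → windowSum qs a (suc e) < + 0

  toℕ≡⇒< : ∀ {d} (i : Fin ℓ) → toℕ i ≡ d → suc d ≤ ℓ
  toℕ≡⇒< i refl = Fin.toℕ<n i

  toℕ-inject₁≡ : ∀ {m d} (i : Fin m) → toℕ (suc i) ≡ suc d → toℕ (inject₁ i) ≡ d
  toℕ-inject₁≡ i 1+i≡1+d = trans (Fin.toℕ-inject₁ i) (ℕ.suc-injective 1+i≡1+d)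

  window-sound : ∀ d a (i : Fin ℓ) → toℕ i ≡ d → ∀ {qs g} → Run (suc (d ℕ.+ a)) qs →
                 f (suc (d ℕ.+ a)) (qs (suc (d ℕ.+ a))) ≡ just g → OpenWindow qs a (suc d) →
                 g i ℤ.≤ windowSum qs a (suc d)
  window-sound zero a zero refl {qs} run fq _ with is-just⇒≡just (Run-supp run a (ℕ.n≤1+n a))
  ... | _ , fp = succF-≤ G fq fp (Run-step run (ℕ.n<1+n a)) first
                   (windowSum-floor a 1 run ℕ.≤-refl (toℕ≡⇒< zero refl))
                   (ℤ.≤-reflexive (sym (windowSum-one qs a)))
  window-sound (suc d) a (suc i) 1+i≡1+d {qs} run fq win
    with is-just⇒≡just (Run-supp run (suc (d ℕ.+ a)) (ℕ.n≤1+n _))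
  ... | h , fp = succF-≤ G fq fp (Run-step run (ℕ.n<1+n _)) (later h[i]<0)
                   (windowSum-floor a (suc (suc d)) run ℕ.≤-refl (toℕ≡⇒< (suc i) 1+i≡1+d))
                   extended
    where
    prefix : h (inject₁ i) ℤ.≤ windowSum qs a (suc d)
    prefix = window-sound d a (inject₁ i) (toℕ-inject₁≡ i 1+i≡1+d) (Run-pred run) fp
               (λ e e<1+d → win e (ℕ.m<n⇒m<1+n e<1+d))
    h[i]<0 : h (inject₁ i) < + 0
    h[i]<0 = ℤ.≤-<-trans prefix (win d (ℕ.m<n⇒m<1+n (ℕ.n<1+n d)))
    extended : h (inject₁ i) ℤ.+ stepWeight qs (suc (d ℕ.+ a)) ℤ.≤ windowSum qs a (suc (suc d))
    extended = ℤ.≤-trans (ℤ.+-monoˡ-≤ _ prefix) (ℤ.≤-reflexive (sym (windowSum-suc qs a (suc d))))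

  extend-last : ∀ {k qs p} q → qs k ≡ p → stepWeight (extend qs k q) k ≡ w p (σs k) q
  extend-last {k} {qs} q qk≡p =
    cong₂ (λ x y → w x (σs k) y) (trans (extend-≤ qs q ℕ.≤-refl) qk≡p) (extend-suc qs k q)

  window-complete : Supp⊆o₀ → ∀ d a (i : Fin ℓ) → toℕ i ≡ d →
                    ∀ {q g} → f (suc (d ℕ.+ a)) q ≡ just g → g i < + 0 →
                    ∃ λ qs → RunTo (suc (d ℕ.+ a)) qs q × OpenWindow qs a (suc d) ×
                             windowSum qs a (suc d) ℤ.≤ g i
  window-complete φ⊆o₀ zero a zero refl {q} {g} fq g₀<0
    with succF-<0 G fq g₀<0 | succF-just⁻ G fq
  ... | p , _ , _ , fp , p→q , first , w≤g₀ | _ , obs≡ , _ with reach φ⊆o₀ a (cong is-just fp)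
  ... | qs₀ , runTo₀@(_ , qs₀a≡p) = qs , RunTo-extend runTo₀ p→q obs≡ , win , sum≤
    where
    qs = extend qs₀ a q
    sum≤ : windowSum qs a 1 ℤ.≤ g zero
    sum≤ = ℤ.≤-trans (ℤ.≤-reflexive (trans (windowSum-one qs a) (extend-last q qs₀a≡p))) w≤g₀
    win : OpenWindow qs a 1
    win zero _ = ℤ.≤-<-trans sum≤ g₀<0
    win (suc _) (s≤s ())
  window-complete φ⊆o₀ (suc d) a (suc i) 1+i≡1+d {q} {g} fq g<0
    with succF-<0 G fq g<0 | succF-just⁻ G fq
  ... | p , h , _ , fp , p→q , later h[i]<0 , v≤g | _ , obs≡ , _
    with window-complete φ⊆o₀ d a (inject₁ i) (toℕ-inject₁≡ i 1+i≡1+d) fp h[i]<0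
  ... | qs₀ , runTo₀@(_ , qs₀k≡p) , win₀ , sum₀≤ =
    qs , RunTo-extend runTo₀ p→q obs≡ , win , sum≤
    where
    k = suc (d ℕ.+ a)
    qs = extend qs₀ k q
    prefix : ∀ {len} → len ≤ suc d → windowSum qs a len ≡ windowSum qs₀ a len
    prefix len≤1+d =
      windowSum-cong a _ (λ t t≤len+a → extend-≤ qs₀ q (ℕ.≤-trans t≤len+a (ℕ.+-monoˡ-≤ a len≤1+d)))
    sum≤ : windowSum qs a (suc (suc d)) ℤ.≤ g (suc i)
    sum≤ = begin
      windowSum qs a (suc (suc d))                 ≡⟨ windowSum-suc qs a (suc d) ⟩
      windowSum qs a (suc d) ℤ.+ stepWeight qs k   ≡⟨ cong₂ ℤ._+_ (prefix ℕ.≤-refl) (extend-last q qs₀k≡p) ⟩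
      windowSum qs₀ a (suc d) ℤ.+ w p (σs k) q     ≤⟨ ℤ.+-monoˡ-≤ _ sum₀≤ ⟩
      h (inject₁ i) ℤ.+ w p (σs k) q               ≤⟨ v≤g ⟩
      g (suc i)                                    ∎
      where open ℤ.≤-Reasoning
    win : OpenWindow qs a (suc (suc d))
    win e e<2+d with ℕ.m<1+n⇒m<n∨m≡n e<2+d
    ... | inj₁ e<1+d = subst (_< + 0) (sym (prefix e<1+d)) (win₀ e e<1+d)
    ... | inj₂ refl  = ℤ.≤-<-trans sum≤ g<0

  window-open⇔ : Supp⊆o₀ → ∀ d a (i : Fin ℓ) → toℕ i ≡ d →
                 ∀ {p g} → f (suc (d ℕ.+ a)) p ≡ just g →
                 (∃ λ qs → RunTo (suc (d ℕ.+ a)) qs p × OpenWindow qs a (suc d)) ⇔ g i < + 0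
  window-open⇔ φ⊆o₀ d a i i≡d {p} {g} fp = mk⇔ sound complete
    where
    sound : (∃ λ qs → RunTo (suc (d ℕ.+ a)) qs p × OpenWindow qs a (suc d)) → g i < + 0
    sound (qs , (run , end≡p) , win) =
      ℤ.≤-<-trans (window-sound d a i i≡d run f-end≡g win) (win d (ℕ.n<1+n d))
      where
      f-end≡g : f (suc (d ℕ.+ a)) (qs (suc (d ℕ.+ a))) ≡ just g
      f-end≡g = subst (λ x → f (suc (d ℕ.+ a)) x ≡ just g) (sym end≡p) fp
    complete : g i < + 0 → ∃ λ qs → RunTo (suc (d ℕ.+ a)) qs p × OpenWindow qs a (suc d)
    complete g<0 with window-complete φ⊆o₀ d a i i≡d fp g<0
    ... | qs , runTo , win , _ = qs , runTo , win

  sums<0⇔OpenWindow : ∀ qs l a →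
    (∀ m → l ℕ.+ a ∸ l ≤ m → m ℕ.< l ℕ.+ a → sumFromTo G σs qs (l ℕ.+ a ∸ l) m < + 0) ⇔
    OpenWindow qs a l
  sums<0⇔OpenWindow qs l a rewrite ℕ.m+n∸m≡n l a = mk⇔ to from
    where
    to : (∀ m → a ≤ m → m ℕ.< l ℕ.+ a → sumFromTo G σs qs a m < + 0) → OpenWindow qs a l
    to sums<0 e e<l = subst (_< + 0) (sumFromTo≡windowSum qs a e)
                        (sums<0 (e ℕ.+ a) (ℕ.m≤n+m a e) (ℕ.+-monoˡ-< a e<l))
    from : OpenWindow qs a l → ∀ m → a ≤ m → m ℕ.< l ℕ.+ a → sumFromTo G σs qs a m < + 0
    from win m a≤m m<l+a = subst (λ x → sumFromTo G σs qs a x < + 0) m∸a+a≡m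
      (subst (_< + 0) (sym (sumFromTo≡windowSum qs a (m ∸ a)))
        (win (m ∸ a) (ℕ.+-cancelʳ-< a (m ∸ a) l (subst (ℕ._< l ℕ.+ a) (sym m∸a+a≡m) m<l+a))))
      where
      m∸a+a≡m : m ∸ a ℕ.+ a ≡ m
      m∸a+a≡m = ℕ.m∸n+n≡m a≤m

  WindowOpen⇔ : ∀ l a {p} → WindowOpen G (l ℕ.+ a) os σs φ l p ⇔
                           (∃ λ qs → RunTo (l ℕ.+ a) qs p × OpenWindow qs a l)
  WindowOpen⇔ l a = mk⇔
    (λ (qs , γ , φ₀ , end≡p , sums<0) →
       qs , ((γ , φ₀) , end≡p) , Equivalence.to (sums<0⇔OpenWindow qs l a) sums<0)
    (λ (qs , ((γ , φ₀) , end≡p) , win) →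
       qs , γ , φ₀ , end≡p , Equivalence.from (sums<0⇔OpenWindow qs l a) win)

lemma4 : (G : WGA) (ℓmax : ℕ) (n : ℕ)
    (os : ℕ → Ob G) (σs : ℕ → Act G) → AbstractPath G n os σs →
    (φ : FF G ℓmax) → InRange G ℓmax φ →
    (∀ q → is-just (φ q) ≡ true → WGA.obs G q ≡ os 0) →
    (p : Q G) (g : Fin ℓmax → ℤ) → suppInv G os σs φ n p ≡ just g →
    (i : Fin ℓmax) → suc (toℕ i) ≤ n →
    WindowOpen G n os σs φ (suc (toℕ i)) p ⇔ (g i < + 0)
lemma4 G ℓmax n os σs _ φ _ φ⊆o₀ p g fn≡g i l≤n with ℕ.m≤n⇒∃[o]m+o≡n l≤n
... | a , refl = ⇔.trans (WindowOpen⇔ (suc (toℕ i)) a) (window-open⇔ φ⊆o₀ (toℕ i) a i refl fn≡g)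
  where open Runs G os σs φ
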